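{- Let $G=(V,E)$ be a finite graph and $\ell \ge 0$ an integer such that (i) $V = V_0 \sqcup V_1 \sqcup \dots \sqcup V_\ell$ (disjoint union), and every edge of $G$ joins a vertex of $V_i$ to a vertex of $V_j$ with $|i-j|=1$; (ii) for every $0 \le i < \lfloor \ell/2\rfloor$ and every $X \subseteq V_i$, the number of neighbors of $X$ in $V_{i+1}$ is at least $|X|$; (iii) for every $\lceil \ell/2\rceil < i \le \ell$ and every $X \subseteq V_i$, the number of neighbors of $X$ in $V_{i-1}$ is at least $|X|$. Then $G$ admits a maximal matching of cardinality at most \[ \frac{|V|}{3} + 6\max\{|V_{\lfloor \ell/2\rfloor}|,\ |V_{\lceil \ell/2\rceil}|\}. \]
   Context: A matching is a set of pairwise vertex-disjoint edges; it is maximal if it is maximal with respect to inclusion. The neighbors of a set $X$ in $V_j$ are the vertices of $V_j$ adjacent to at least one vertex of $X$. -}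

module Defs where

open import Data.Nat using (ℕ; zero; suc; _+_; _*_; _≤_; _<_; _⊔_; _≡ᵇ_; _∸_; ⌊_/2⌋; ⌈_/2⌉)
open import Data.Bool using (Bool; true; false; _∧_; _∨_; T)
open import Data.Fin using (Fin; toℕ)
open import Data.Fin.Subset using (Subset; _⊆_; ∣_∣)
open import Data.Vec using (tabulate)
open import Data.List using (List; length)
open import Data.List.Relation.Unary.All using (All)
open import Data.List.Relation.Unary.Any using (Any)
open import Data.List.Relation.Unary.AllPairs using (AllPairs)
open import Data.Product using (_×_; Σ; _,_)
import Data.Vec
open import Data.Sum using (_⊎_)
open import Relation.Binary.PropositionalEquality using (_≡_)
open import Relation.Nullary using (¬_)

record Graph (n : ℕ) : Set where
  field
    adj     : Fin n → Fin n → Bool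
    adj-sym : ∀ u v → adj u v ≡ adj v u
    irrefl  : ∀ v → adj v v ≡ false
open Graph public

anyFin : {n : ℕ} → (Fin n → Bool) → Bool
anyFin {zero}  f = false
anyFin {suc n} f = f Fin.zero ∨ anyFin (λ i → f (Fin.suc i))

Vertex-pair : ℕ → Set
Vertex-pair n = Fin n × Fin n

module _ {n : ℕ} (G : Graph n) where

  IsEdge : Vertex-pair n → Set
  IsEdge (u , v) = T (adj G u v)

  SameEdge : Vertex-pair n → Vertex-pair n → Set
  SameEdge (a , b) (c , d) = (a ≡ c × b ≡ d) ⊎ (a ≡ d × b ≡ c)

  Disjoint : Vertex-pair n → Vertex-pair n → Set
  Disjoint (a , b) (c , d) = ¬ a ≡ c × ¬ a ≡ d × ¬ b ≡ c × ¬ b ≡ d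

  _∈E_ : Vertex-pair n → List (Vertex-pair n) → Set
  e ∈E M = Any (SameEdge e) M

  IsMatching : List (Vertex-pair n) → Set
  IsMatching M = All IsEdge M × AllPairs Disjoint M

  IsMaximalMatching : List (Vertex-pair n) → Set
  IsMaximalMatching M =
    IsMatching M ×
    (∀ M′ → IsMatching M′ → (∀ e → e ∈E M → e ∈E M′) → ∀ e → e ∈E M′ → e ∈E M)

  module Layered {ℓ : ℕ} (layer : Fin n → Fin (suc ℓ)) where

    Part : ℕ → Subset n
    Part i = tabulate (λ v → toℕ (layer v) ≡ᵇ i)

    Nbrs : Subset n → ℕ → Subset n
    Nbrs X j = tabulate (λ v → (toℕ (layer v) ≡ᵇ j) ∧
                               anyFin (λ u → Data.Vec.lookup X u ∧ adj G u v))

    EdgesBetweenConsecutive : Set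
    EdgesBetweenConsecutive = ∀ u v → T (adj G u v) →
      (toℕ (layer v) ≡ suc (toℕ (layer u))) ⊎ (toℕ (layer u) ≡ suc (toℕ (layer v)))

    ExpandUp : Set
    ExpandUp = ∀ i → i < ⌊ ℓ /2⌋ → ∀ (X : Subset n) → X ⊆ Part i →
      ∣ X ∣ ≤ ∣ Nbrs X (suc i) ∣

    ExpandDown : Set
    ExpandDown = ∀ i → ⌈ ℓ /2⌉ < i → i ≤ ℓ → ∀ (X : Subset n) → X ⊆ Part i →
      ∣ X ∣ ≤ ∣ Nbrs X (i ∸ 1) ∣

{-# OPTIONS --safe #-}
module Submission where

-- Let B be the band of layers ⌊ℓ/2⌋ … ⌈ℓ/2⌉ + 1 and measure every vertex by the distance d of
-- its layer to B.  In each of three phases p, the vertices of B get the role cover and a vertex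
-- at distance d > 0 gets the role rotate p d in the cycle cover → saturated → free → cover.
-- Hall's theorem, fed by (ii) below B and by (iii) above it, matches the saturated vertices of
-- each layer injectively into the adjacent layer one step closer to B, which is a cover layer.
-- No two adjacent layers are free, so every edge between two vertices left unmatched meets a
-- cover vertex, and therefore so does every edge of a greedy extension to a maximal matching:
-- the maximal matching of phase p has at most as many edges as there are cover vertices.  A
-- vertex outside B is a cover vertex in only one phase, so the three bounds add up to at most
-- n + 3|B|, and |B| ≤ 3 max(|V_⌊ℓ/2⌋|, |V_⌈ℓ/2⌉|) because (iii) bounds the layer ⌈ℓ/2⌉ + 1 by
-- the layer ⌈ℓ/2⌉.

open import Data.Bool using (Bool; T)
open import Data.Bool.Properties using (T-≡; T-∧; T-∨; T?)
open import Data.Fin using (Fin; zero; suc; toℕ)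
open import Data.Fin.Properties using (any?; toℕ<n) renaming (_≟_ to _≟ᶠ_)
open import Data.Fin.Subset hiding (⊥; ⊤)
open import Data.Fin.Subset.Properties
open import Data.List using (List; []; _∷_; foldr; length; map; filter; allFin; cartesianProduct)
open import Data.List.Membership.Propositional using (find; lose) renaming (_∈_ to _∈ₗ_)
open import Data.List.Membership.Propositional.Properties
  using (∈-allFin; ∈-cartesianProduct⁺; ∈-filter⁺; ∈-map⁺)
open import Data.List.Relation.Unary.All as All using (All; []; _∷_)
import Data.List.Relation.Unary.All.Properties as Allₚ
open import Data.List.Relation.Unary.AllPairs using (AllPairs; []; _∷_)
import Data.List.Relation.Unary.AllPairs.Properties as AllPairsₚ
open import Data.List.Relation.Unary.Any as Any using (Any; here; there)
open import Data.List.Relation.Unary.Unique.Propositional.Properties using (allFin⁺)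
open import Data.Nat
  using (ℕ; zero; suc; _+_; _*_; _∸_; _≤_; _<_; _≤?_; _<?_; _⊔_; z≤n; s≤s; ⌊_/2⌋; ⌈_/2⌉)
open import Data.Nat.Induction using (<-wellFounded)
open import Data.Nat.Properties
open import Data.Nat.Solver using (module +-*-Solver)
open import Data.Product using (Σ; ∃; ∃-syntax; _×_; _,_; proj₁; proj₂)
open import Data.Sum as Sum using (_⊎_; inj₁; inj₂; [_,_])
open import Data.Vec using ([]; _∷_; here; there; lookup; tabulate)
open import Data.Vec.Properties using ([]=⇒lookup; lookup⇒[]=; lookup∘tabulate)
open import Function using (_∘_; id; _⇔_; mk⇔; Equivalence)
open import Induction.WellFounded using (Acc; acc)
open import Relation.Binary.PropositionalEquality
  using (_≡_; _≢_; refl; sym; trans; cong; cong₂; subst; module ≡-Reasoning)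
open import Relation.Nullary using (¬_; Dec; yes; no; ¬?; contradiction)
open import Relation.Nullary.Decidable using (isYes; toWitness; fromWitness; _×-dec_; _⊎-dec_)
open import Relation.Unary using (Decidable)

open import Defs

open Equivalence using (to; from)

variable
  n : ℕ

∈⇔T-lookup : ∀ {x : Fin n} {p : Subset n} → x ∈ p ⇔ T (lookup p x)
∈⇔T-lookup {x = x} {p} = mk⇔ (from T-≡ ∘ []=⇒lookup) (lookup⇒[]= x p ∘ to T-≡)

∈-tabulate : ∀ {x : Fin n} {f : Fin n → Bool} → x ∈ tabulate f ⇔ T (f x)
∈-tabulate {x = x} {f} =
  mk⇔ (subst T (lookup∘tabulate f x) ∘ to ∈⇔T-lookup)
      (from ∈⇔T-lookup ∘ subst T (sym (lookup∘tabulate f x)))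

anyFin⁻ : ∀ {f : Fin n → Bool} → T (anyFin f) → ∃[ i ] T (f i)
anyFin⁻ {zero}  ()
anyFin⁻ {suc n} t with to T-∨ t
... | inj₁ f0 = zero , f0
... | inj₂ fs = let i , fi = anyFin⁻ fs in suc i , fi

subset : {P : Fin n → Set} → Decidable P → Subset n
subset P? = tabulate (isYes ∘ P?)

∈-subset : ∀ {P : Fin n → Set} {P? : Decidable P} {x} → x ∈ subset P? ⇔ P x
∈-subset = mk⇔ (toWitness ∘ to ∈-tabulate) (from ∈-tabulate ∘ fromWitness)

x∈p─q⇒x∉q : ∀ {x : Fin n} (p q : Subset n) → x ∈ p ─ q → x ∉ q
x∈p─q⇒x∉q (inside ∷ p) (outside ∷ q) here = λ ()
x∈p─q⇒x∉q (_ ∷ p) (_ ∷ q) (there x∈p─q) (there x∈q) = x∈p─q⇒x∉q p q x∈p─q x∈q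

∣p∪q∣≤∣p∣+∣q∣ : ∀ (p q : Subset n) → ∣ p ∪ q ∣ ≤ ∣ p ∣ + ∣ q ∣
∣p∪q∣≤∣p∣+∣q∣ []            []            = z≤n
∣p∪q∣≤∣p∣+∣q∣ (inside  ∷ p) (inside  ∷ q) =
  s≤s (≤-trans (∣p∪q∣≤∣p∣+∣q∣ p q) (+-monoʳ-≤ ∣ p ∣ (n≤1+n ∣ q ∣)))
∣p∪q∣≤∣p∣+∣q∣ (inside  ∷ p) (outside ∷ q) = s≤s (∣p∪q∣≤∣p∣+∣q∣ p q)
∣p∪q∣≤∣p∣+∣q∣ (outside ∷ p) (inside  ∷ q) =
  ≤-trans (s≤s (∣p∪q∣≤∣p∣+∣q∣ p q)) (≤-reflexive (sym (+-suc ∣ p ∣ ∣ q ∣)))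
∣p∪q∣≤∣p∣+∣q∣ (outside ∷ p) (outside ∷ q) = ∣p∪q∣≤∣p∣+∣q∣ p q

Empty[p∩q]⇒∣p∣+∣q∣≤∣p∪q∣ : ∀ (p q : Subset n) → Empty (p ∩ q) → ∣ p ∣ + ∣ q ∣ ≤ ∣ p ∪ q ∣
Empty[p∩q]⇒∣p∣+∣q∣≤∣p∪q∣ []            []            _ = z≤n
Empty[p∩q]⇒∣p∣+∣q∣≤∣p∪q∣ (inside  ∷ p) (inside  ∷ q) ∅ = contradiction (zero , here) ∅
Empty[p∩q]⇒∣p∣+∣q∣≤∣p∪q∣ (inside  ∷ p) (outside ∷ q) ∅ =
  s≤s (Empty[p∩q]⇒∣p∣+∣q∣≤∣p∪q∣ p q (drop-∷-Empty ∅))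
Empty[p∩q]⇒∣p∣+∣q∣≤∣p∪q∣ (outside ∷ p) (inside  ∷ q) ∅ =
  ≤-trans (≤-reflexive (+-suc ∣ p ∣ ∣ q ∣)) (s≤s (Empty[p∩q]⇒∣p∣+∣q∣≤∣p∪q∣ p q (drop-∷-Empty ∅)))
Empty[p∩q]⇒∣p∣+∣q∣≤∣p∪q∣ (outside ∷ p) (outside ∷ q) ∅ =
  Empty[p∩q]⇒∣p∣+∣q∣≤∣p∪q∣ p q (drop-∷-Empty ∅)

Empty⇒∣p∣≡0 : ∀ {p : Subset n} → Empty p → ∣ p ∣ ≡ 0
Empty⇒∣p∣≡0 {n} ∅ = trans (cong ∣_∣ (Empty-unique ∅)) (∣⊥∣≡0 n)

0<∣p∣⇒Nonempty : ∀ {p : Subset n} → 0 < ∣ p ∣ → Nonempty p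
0<∣p∣⇒Nonempty {p = p} 0<∣p∣ with nonempty? p
... | yes p≢∅ = p≢∅
... | no  p≡∅ with () ← subst (0 <_) (Empty⇒∣p∣≡0 p≡∅) 0<∣p∣

-- Hall's theorem

neighbourhood : (Fin n → Subset n) → Subset n → Subset n
neighbourhood Γ X = subset (λ v → any? (λ u → u ∈? X ×-dec v ∈? Γ u))

HallCondition : (Fin n → Subset n) → Subset n → Set
HallCondition Γ A = ∀ X → X ⊆ A → ∣ X ∣ ≤ ∣ neighbourhood Γ X ∣

Saturates : (Fin n → Subset n) → Subset n → (Fin n → Fin n) → Set
Saturates Γ A f = (∀ {u} → u ∈ A → f u ∈ Γ u) × (∀ {u w} → u ∈ A → w ∈ A → f u ≡ f w → u ≡ w)

∈-neighbourhood⁺ : ∀ {Γ : Fin n → Subset n} {X u v} → u ∈ X → v ∈ Γ u → v ∈ neighbourhood Γ X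
∈-neighbourhood⁺ u∈X v∈Γu = from ∈-subset (_ , u∈X , v∈Γu)

∈-neighbourhood⁻ : ∀ {Γ : Fin n → Subset n} {X v} → v ∈ neighbourhood Γ X → ∃[ u ] u ∈ X × v ∈ Γ u
∈-neighbourhood⁻ = to ∈-subset

module _ {Γ : Fin n → Subset n} where

  neighbourhood⊆T∪ : ∀ {X} T → neighbourhood Γ X ⊆ T ∪ neighbourhood (λ u → Γ u ─ T) X
  neighbourhood⊆T∪ {X} T {v} v∈N with v ∈? T | ∈-neighbourhood⁻ v∈N
  ... | yes v∈T | _              = x∈p∪q⁺ (inj₁ v∈T)
  ... | no  v∉T | u , u∈X , v∈Γu = x∈p∪q⁺ (inj₂ (∈-neighbourhood⁺ u∈X (x∈p∧x∉q⇒x∈p─q v∈Γu v∉T)))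

  neighbourhood-∪⊆ : ∀ X Y → neighbourhood Γ (X ∪ Y) ⊆
                     neighbourhood Γ X ∪ neighbourhood (λ u → Γ u ─ neighbourhood Γ X) Y
  neighbourhood-∪⊆ X Y {v} v∈N with v ∈? neighbourhood Γ X | ∈-neighbourhood⁻ v∈N
  ... | yes v∈NX | _ = x∈p∪q⁺ (inj₁ v∈NX)
  ... | no  v∉NX | u , u∈X∪Y , v∈Γu with x∈p∪q⁻ X Y u∈X∪Y
  ...   | inj₁ u∈X = contradiction (∈-neighbourhood⁺ u∈X v∈Γu) v∉NX
  ...   | inj₂ u∈Y = x∈p∪q⁺ (inj₂ (∈-neighbourhood⁺ u∈Y (x∈p∧x∉q⇒x∈p─q v∈Γu v∉NX)))

  Saturates-glue : ∀ {A X T f g} → Saturates Γ X f → (∀ {u} → u ∈ X → f u ∈ T) →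
                   Saturates (λ u → Γ u ─ T) (A ─ X) g → ∃ (Saturates Γ A)
  Saturates-glue {A} {X} {T} {f} {g} (f∈Γ , f-inj) f∈T (g∈Γ─T , g-inj) = h , h∈Γ , h-inj
    where
    pick : ∀ {u} → Dec (u ∈ X) → Fin n
    pick {u} (yes _) = f u
    pick {u} (no  _) = g u

    h : Fin n → Fin n
    h u = pick (u ∈? X)

    g∈Γ─T′ : ∀ {u} → u ∈ A → u ∉ X → g u ∈ Γ u ─ T
    g∈Γ─T′ u∈A u∉X = g∈Γ─T (x∈p∧x∉q⇒x∈p─q u∈A u∉X)

    h∈Γ : ∀ {u} → u ∈ A → h u ∈ Γ u
    h∈Γ {u} u∈A with u ∈? X
    ... | yes u∈X = f∈Γ u∈X
    ... | no  u∉X = p─q⊆p _ T (g∈Γ─T′ u∈A u∉X)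

    h-inj : ∀ {u w} → u ∈ A → w ∈ A → h u ≡ h w → u ≡ w
    h-inj {u} {w} u∈A w∈A hu≡hw with u ∈? X | w ∈? X
    ... | yes u∈X | yes w∈X = f-inj u∈X w∈X hu≡hw
    ... | yes u∈X | no  w∉X =
      contradiction (subst (_∈ T) hu≡hw (f∈T u∈X)) (x∈p─q⇒x∉q _ T (g∈Γ─T′ w∈A w∉X))
    ... | no  u∉X | yes w∈X =
      contradiction (subst (_∈ T) (sym hu≡hw) (f∈T w∈X)) (x∈p─q⇒x∉q _ T (g∈Γ─T′ u∈A u∉X))
    ... | no  u∉X | no  w∉X =
      g-inj (x∈p∧x∉q⇒x∈p─q u∈A u∉X) (x∈p∧x∉q⇒x∈p─q w∈A w∉X) hu≡hw

Critical : (Fin n → Subset n) → Subset n → Subset n → Set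
Critical Γ A X = Nonempty X × X ⊂ A × ∣ neighbourhood Γ X ∣ ≤ ∣ X ∣

critical? : ∀ (Γ : Fin n → Subset n) A → Decidable (Critical Γ A)
critical? Γ A X = nonempty? X ×-dec X ⊂? A ×-dec ∣ neighbourhood Γ X ∣ ≤? ∣ X ∣

HallFor : Subset n → Set
HallFor {n} A = (Γ : Fin n → Subset n) → HallCondition Γ A → ∃ (Saturates Γ A)

module _ {A : Subset n} (hall< : ∀ {B : Subset n} → ∣ B ∣ < ∣ A ∣ → HallFor B)
         (Γ : Fin n → Subset n) (hallA : HallCondition Γ A) where

  hall-critical : ∀ {X} → Critical Γ A X → ∃ (Saturates Γ A)
  hall-critical {X} ((x , x∈X) , X⊂A@(X⊆A , _) , ∣NX∣≤∣X∣) =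
    let f , f-sat = hall< (p⊂q⇒∣p∣<∣q∣ X⊂A) Γ (λ Y Y⊆X → hallA Y (⊆-trans Y⊆X X⊆A))
        _ , g-sat = hall< (p∩q≢∅⇒∣p─q∣<∣p∣ A X (x , x∈p∩q⁺ (X⊆A x∈X , x∈X))) _ hallA─X
    in Saturates-glue f-sat (λ u∈X → ∈-neighbourhood⁺ u∈X (proj₁ f-sat u∈X)) g-sat
    where
    hallA─X : HallCondition (λ u → Γ u ─ neighbourhood Γ X) (A ─ X)
    hallA─X Y Y⊆A─X = +-cancelˡ-≤ ∣ X ∣ ∣ Y ∣ _ (begin
      ∣ X ∣ + ∣ Y ∣                ≤⟨ Empty[p∩q]⇒∣p∣+∣q∣≤∣p∪q∣ X Y X∩Y≡∅ ⟩
      ∣ X ∪ Y ∣                    ≤⟨ hallA (X ∪ Y) X∪Y⊆A ⟩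
      ∣ neighbourhood Γ (X ∪ Y) ∣  ≤⟨ p⊆q⇒∣p∣≤∣q∣ (neighbourhood-∪⊆ X Y) ⟩
      ∣ NX ∪ N′Y ∣                 ≤⟨ ∣p∪q∣≤∣p∣+∣q∣ NX N′Y ⟩
      ∣ NX ∣ + ∣ N′Y ∣             ≤⟨ +-monoˡ-≤ ∣ N′Y ∣ ∣NX∣≤∣X∣ ⟩
      ∣ X ∣ + ∣ N′Y ∣              ∎)
      where
      open ≤-Reasoning
      NX  = neighbourhood Γ X
      N′Y = neighbourhood (λ u → Γ u ─ NX) Y

      X∪Y⊆A : X ∪ Y ⊆ A
      X∪Y⊆A x∈X∪Y = [ X⊆A , p─q⊆p A X ∘ Y⊆A─X ] (x∈p∪q⁻ X Y x∈X∪Y)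

      X∩Y≡∅ : Empty (X ∩ Y)
      X∩Y≡∅ (x , x∈X∩Y) =
        let x∈X , x∈Y = x∈p∩q⁻ X Y x∈X∩Y in x∈p─q⇒x∉q A X (Y⊆A─X x∈Y) x∈X

  hall⇒neighbour : ∀ {a} → a ∈ A → ∃[ b ] b ∈ Γ a
  hall⇒neighbour {a} a∈A with ∈-neighbourhood⁻ {Γ = Γ} (proj₂ (0<∣p∣⇒Nonempty 0<∣N⁅a⁆∣))
    where
    ⁅a⁆⊆A : ⁅ a ⁆ ⊆ A
    ⁅a⁆⊆A x∈⁅a⁆ = subst (_∈ A) (sym (x∈⁅y⁆⇒x≡y a x∈⁅a⁆)) a∈A

    0<∣N⁅a⁆∣ : 0 < ∣ neighbourhood Γ ⁅ a ⁆ ∣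
    0<∣N⁅a⁆∣ = subst (_≤ ∣ neighbourhood Γ ⁅ a ⁆ ∣) (∣⁅x⁆∣≡1 a) (hallA ⁅ a ⁆ ⁅a⁆⊆A)
  ... | u , u∈⁅a⁆ , b∈Γu with refl ← x∈⁅y⁆⇒x≡y a u∈⁅a⁆ = _ , b∈Γu

  hall-noncritical : ∀ {a} → a ∈ A → ¬ ∃ (Critical Γ A) → ∃ (Saturates Γ A)
  hall-noncritical {a} a∈A noncritical with hall⇒neighbour a∈A
  ... | b , b∈Γa =
    Saturates-glue {X = ⁅ a ⁆} {T = ⁅ b ⁆} {f = λ _ → b} (b∈Γ , b-inj) (λ _ → x∈⁅x⁆ b)
      (proj₂ (hall< (x∈p⇒∣p-x∣<∣p∣ a∈A) (λ u → Γ u - b) hallA-a))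
    where
    b∈Γ : ∀ {u} → u ∈ ⁅ a ⁆ → b ∈ Γ u
    b∈Γ u∈⁅a⁆ = subst (λ u → b ∈ Γ u) (sym (x∈⁅y⁆⇒x≡y a u∈⁅a⁆)) b∈Γa

    b-inj : ∀ {u w} → u ∈ ⁅ a ⁆ → w ∈ ⁅ a ⁆ → b ≡ b → u ≡ w
    b-inj u∈⁅a⁆ w∈⁅a⁆ _ = trans (x∈⁅y⁆⇒x≡y a u∈⁅a⁆) (sym (x∈⁅y⁆⇒x≡y a w∈⁅a⁆))

    hallA-a : HallCondition (λ u → Γ u - b) (A - a)
    hallA-a Y Y⊆A-a with nonempty? Y
    ... | no  Y≡∅ = subst (_≤ ∣ neighbourhood (λ u → Γ u - b) Y ∣) (sym (Empty⇒∣p∣≡0 Y≡∅)) z≤n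
    ... | yes Y≢∅ = ≤-pred (begin-strict
      ∣ Y ∣                  <⟨ ≰⇒> (λ ∣NY∣≤∣Y∣ → noncritical (Y , Y≢∅ , Y⊂A , ∣NY∣≤∣Y∣)) ⟩
      ∣ neighbourhood Γ Y ∣  ≤⟨ p⊆q⇒∣p∣≤∣q∣ (neighbourhood⊆T∪ {X = Y} ⁅ b ⁆) ⟩
      ∣ ⁅ b ⁆ ∪ N′Y ∣        ≤⟨ ∣p∪q∣≤∣p∣+∣q∣ ⁅ b ⁆ N′Y ⟩
      ∣ ⁅ b ⁆ ∣ + ∣ N′Y ∣    ≡⟨ cong (_+ ∣ N′Y ∣) (∣⁅x⁆∣≡1 b) ⟩
      suc ∣ N′Y ∣            ∎)
      where
      open ≤-Reasoning
      N′Y = neighbourhood (λ u → Γ u - b) Y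

      Y⊂A : Y ⊂ A
      Y⊂A = p─q⊆p A ⁅ a ⁆ ∘ Y⊆A-a , a , a∈A ,
            λ a∈Y → x∈p─q⇒x∉q A ⁅ a ⁆ (Y⊆A-a a∈Y) (x∈⁅x⁆ a)

-- Halmos–Vaughan: a critical X splits the problem into matching X into N(X) and A ─ X away
-- from N(X); without one, every nonempty X ⊂ A has a neighbour to spare, so matching any
-- a ∈ A to any neighbour b preserves Hall's condition for A - a with b removed.
hall-step : ∀ {A : Subset n} → (∀ {B : Subset n} → ∣ B ∣ < ∣ A ∣ → HallFor B) → HallFor A
hall-step {A = A} hall< Γ hallA with nonempty? A
... | no  A≡∅ = id , (λ u∈A → contradiction (_ , u∈A) A≡∅) , (λ u∈A → contradiction (_ , u∈A) A≡∅)
... | yes (a , a∈A) with anySubset? (critical? Γ A)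
...   | yes (_ , critical) = hall-critical hall< Γ hallA critical
...   | no  noncritical    = hall-noncritical hall< Γ hallA a∈A noncritical

hall-acc : ∀ {A : Subset n} → Acc _<_ ∣ A ∣ → HallFor A
hall-acc (acc rs) = hall-step (λ ∣B∣<∣A∣ → hall-acc (rs ∣B∣<∣A∣))

hall : ∀ (Γ : Fin n → Subset n) A → HallCondition Γ A → ∃ (Saturates Γ A)
hall Γ A = hall-acc (<-wellFounded ∣ A ∣) Γ

-- Matchings

module Matchings {n : ℕ} (G : Graph n) where

  Endpoint : Fin n → Vertex-pair n → Set
  Endpoint w (u , v) = w ≡ u ⊎ w ≡ v

  Covered : Fin n → List (Vertex-pair n) → Set
  Covered w = Any (Endpoint w)

  covered? : ∀ w M → Dec (Covered w M)
  covered? w = Any.any? λ (u , v) → (w ≟ᶠ u) ⊎-dec (w ≟ᶠ v)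

  Free : List (Vertex-pair n) → Vertex-pair n → Set
  Free M (u , v) = IsEdge G (u , v) × ¬ Covered u M × ¬ Covered v M

  free? : ∀ M e → Dec (Free M e)
  free? M (u , v) = T? (adj G u v) ×-dec ¬? (covered? u M) ×-dec ¬? (covered? v M)

  Meets : Subset n → Vertex-pair n → Set
  Meets S e = ∃[ w ] Endpoint w e × w ∈ S

  Endpoint-resp : ∀ {w e f} → SameEdge G e f → Endpoint w e → Endpoint w f
  Endpoint-resp (inj₁ (refl , refl)) w∈e        = w∈e
  Endpoint-resp (inj₂ (refl , refl)) (inj₁ w≡u) = inj₂ w≡u
  Endpoint-resp (inj₂ (refl , refl)) (inj₂ w≡v) = inj₁ w≡v

  Disjoint⇒¬Endpoint : ∀ {w e f} → Disjoint G e f → Endpoint w e → ¬ Endpoint w f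
  Disjoint⇒¬Endpoint (a≢c , _ , _ , _) (inj₁ refl) (inj₁ w≡c) = a≢c w≡c
  Disjoint⇒¬Endpoint (_ , a≢d , _ , _) (inj₁ refl) (inj₂ w≡d) = a≢d w≡d
  Disjoint⇒¬Endpoint (_ , _ , b≢c , _) (inj₂ refl) (inj₁ w≡c) = b≢c w≡c
  Disjoint⇒¬Endpoint (_ , _ , _ , b≢d) (inj₂ refl) (inj₂ w≡d) = b≢d w≡d

  SameEdge-common : ∀ {e f c} → SameEdge G e c → SameEdge G f c → SameEdge G e f
  SameEdge-common (inj₁ (refl , refl)) (inj₁ (refl , refl)) = inj₁ (refl , refl)
  SameEdge-common (inj₁ (refl , refl)) (inj₂ (refl , refl)) = inj₂ (refl , refl)
  SameEdge-common (inj₂ (refl , refl)) (inj₁ (refl , refl)) = inj₂ (refl , refl)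
  SameEdge-common (inj₂ (refl , refl)) (inj₂ (refl , refl)) = inj₁ (refl , refl)

  IsEdge-∈E : ∀ {e M} → All (IsEdge G) M → _∈E_ G e M → IsEdge G e
  IsEdge-∈E         (uv ∷ _)    (here (inj₁ (refl , refl))) = uv
  IsEdge-∈E {v , u} (uv ∷ _)    (here (inj₂ (refl , refl))) = subst T (adj-sym G u v) uv
  IsEdge-∈E         (_ ∷ edges) (there e∈M)                 = IsEdge-∈E edges e∈M

  shared-endpoint : ∀ {M e f w} → AllPairs (Disjoint G) M → _∈E_ G e M → _∈E_ G f M →
                    Endpoint w e → Endpoint w f → SameEdge G e f
  shared-endpoint (_ ∷ _) (here e~c) (here f~c) _ _ = SameEdge-common e~c f~c
  shared-endpoint (c∩M≡∅ ∷ _) (here e~c) (there f∈M) w∈e w∈f =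
    let c∩d≡∅ , f~d = All.lookupAny c∩M≡∅ f∈M
    in contradiction (Endpoint-resp f~d w∈f) (Disjoint⇒¬Endpoint c∩d≡∅ (Endpoint-resp e~c w∈e))
  shared-endpoint (c∩M≡∅ ∷ _) (there e∈M) (here f~c) w∈e w∈f =
    let c∩d≡∅ , e~d = All.lookupAny c∩M≡∅ e∈M
    in contradiction (Endpoint-resp e~d w∈e) (Disjoint⇒¬Endpoint c∩d≡∅ (Endpoint-resp f~c w∈f))
  shared-endpoint (_ ∷ disjoint) (there e∈M) (there f∈M) = shared-endpoint disjoint e∈M f∈M

  covered-endpoint : ∀ {M e} → IsEdge G e → ¬ Free M e → ∃[ w ] Endpoint w e × Covered w M
  covered-endpoint {M} {u , v} uv ¬free with covered? u M | covered? v M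
  ... | yes u-covered  | _             = u , inj₁ refl , u-covered
  ... | no  _          | yes v-covered = v , inj₂ refl , v-covered
  ... | no  ¬u-covered | no ¬v-covered = contradiction (uv , ¬u-covered , ¬v-covered) ¬free

  noFree⇒maximal : ∀ {M} → IsMatching G M → (∀ e → ¬ Free M e) → IsMaximalMatching G M
  noFree⇒maximal {M} matching blocked = matching , maximal
    where
    maximal : ∀ M′ → IsMatching G M′ → (∀ e → _∈E_ G e M → _∈E_ G e M′) →
              ∀ e → _∈E_ G e M′ → _∈E_ G e M
    maximal M′ (edges′ , disjoint′) M⊆M′ e e∈M′
      with covered-endpoint (IsEdge-∈E edges′ e∈M′) (blocked e)
    ... | w , w∈e , w-covered with find w-covered
    ...   | f , f∈M , w∈f =
      lose f∈M (shared-endpoint disjoint′ e∈M′ (M⊆M′ f (lose f∈M (inj₁ (refl , refl)))) w∈e w∈f)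

  uncovered⇒Disjoint : ∀ {u v M} → ¬ Covered u M → ¬ Covered v M → All (Disjoint G (u , v)) M
  uncovered⇒Disjoint ¬u-covered ¬v-covered = All.tabulate λ f∈M →
    (¬u-covered ∘ lose f∈M ∘ inj₁) , (¬u-covered ∘ lose f∈M ∘ inj₂) ,
    (¬v-covered ∘ lose f∈M ∘ inj₁) , (¬v-covered ∘ lose f∈M ∘ inj₂)

  addIfFree : Vertex-pair n → List (Vertex-pair n) → List (Vertex-pair n)
  addIfFree e M with free? M e
  ... | yes _ = e ∷ M
  ... | no  _ = M

  addIfFree-covers : ∀ {w e M} → Covered w M → Covered w (addIfFree e M)
  addIfFree-covers {e = e} {M} w-covered with free? M e
  ... | yes _ = there w-covered
  ... | no  _ = w-covered

  addIfFree-blocks : ∀ e M → ¬ Free (addIfFree e M) e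
  addIfFree-blocks (u , v) M with free? M (u , v)
  ... | yes _     = λ (_ , ¬u-covered , _) → ¬u-covered (here (inj₁ refl))
  ... | no  ¬free = ¬free

  Free-anti : ∀ {M M′ e} → (∀ {w} → Covered w M → Covered w M′) → Free M′ e → Free M e
  Free-anti M⊑M′ (uv , ¬u-covered , ¬v-covered) = uv , ¬u-covered ∘ M⊑M′ , ¬v-covered ∘ M⊑M′

  greedy : List (Vertex-pair n) → List (Vertex-pair n) → List (Vertex-pair n)
  greedy es M = foldr addIfFree M es

  greedy-blocks : ∀ {e} es M → e ∈ₗ es → ¬ Free (greedy es M) e
  greedy-blocks (e ∷ es) M (here refl)  = addIfFree-blocks e (greedy es M)
  greedy-blocks (_ ∷ es) M (there e∈es) = greedy-blocks es M e∈es ∘ Free-anti addIfFree-covers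

  module _ (Good : Vertex-pair n → Set) (M₀ : List (Vertex-pair n))
           (free⇒Good : ∀ {e} → Free M₀ e → Good e) where

    Invariant : List (Vertex-pair n) → Set
    Invariant M = IsMatching G M × All Good M × (∀ {w} → Covered w M₀ → Covered w M)

    addIfFree-invariant : ∀ {M} e → Invariant M → Invariant (addIfFree e M)
    addIfFree-invariant {M} e inv@((edges , disjoint) , good , M₀⊑M) with free? M e
    ... | no  _ = inv
    ... | yes free@(uv , ¬u-covered , ¬v-covered) =
      (uv ∷ edges , uncovered⇒Disjoint ¬u-covered ¬v-covered ∷ disjoint) ,
      free⇒Good (Free-anti M₀⊑M free) ∷ good , there ∘ M₀⊑M

    greedy-invariant : ∀ es → Invariant M₀ → Invariant (greedy es M₀)
    greedy-invariant []       inv = inv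
    greedy-invariant (e ∷ es) inv = addIfFree-invariant e (greedy-invariant es inv)

    extend-to-maximal : IsMatching G M₀ → All Good M₀ → ∃[ M ] IsMaximalMatching G M × All Good M
    extend-to-maximal matching good =
      let matching′ , good′ , _ = greedy-invariant pairs (matching , good , id)
      in greedy pairs M₀ , noFree⇒maximal matching′ blocked , good′
      where
      pairs = cartesianProduct (allFin n) (allFin n)

      blocked : ∀ e → ¬ Free (greedy pairs M₀) e
      blocked (u , v) = greedy-blocks pairs M₀ (∈-cartesianProduct⁺ (∈-allFin u) (∈-allFin v))

  Meets-─ : ∀ {S w e f} → Endpoint w e → Disjoint G e f × Meets S f → Meets (S - w) f
  Meets-─ w∈e (e∩f≡∅ , x , x∈f , x∈S) =
    x , x∈f , x∈p∧x≢y⇒x∈p-y x∈S (λ { refl → Disjoint⇒¬Endpoint e∩f≡∅ w∈e x∈f })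

  length≤∣S∣ : ∀ {S M} → AllPairs (Disjoint G) M → All (Meets S) M → length M ≤ ∣ S ∣
  length≤∣S∣ [] [] = z≤n
  length≤∣S∣ (disjoint ∷ disjoints) ((w , w∈e , w∈S) ∷ meets) = <-≤-trans
    (s≤s (length≤∣S∣ disjoints (All.zipWith (Meets-─ w∈e) (disjoint , meets))))
    (x∈p⇒∣p-x∣<∣p∣ w∈S)

-- Layers, roles and phases

-- With truncated subtraction, distance t is the distance from t to the interval [a, b].
module Interval (a b : ℕ) (a<b : a < b) where

  open ≡-Reasoning

  distance : ℕ → ℕ
  distance t = (a ∸ t) + (t ∸ b)

  Outside : ℕ → Set
  Outside t = t < a ⊎ b < t

  outside? : ∀ t → Dec (Outside t)
  outside? t = t <? a ⊎-dec b <? t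

  inward : ℕ → ℕ
  inward t with t <? a
  ... | yes _ = suc t
  ... | no  _ = t ∸ 1

  distance-below : ∀ {t} → t < a → distance t ≡ suc (distance (suc t))
  distance-below {t} t<a = begin
    (a ∸ t) + (t ∸ b)              ≡⟨ cong₂ _+_ (+-∸-assoc 1 t<a) (m≤n⇒m∸n≡0 (<⇒≤ t<b)) ⟩
    suc (a ∸ suc t) + 0            ≡⟨ cong (suc (a ∸ suc t) +_) (sym (m≤n⇒m∸n≡0 t<b)) ⟩
    suc (a ∸ suc t) + (suc t ∸ b)  ∎
    where t<b = <-trans t<a a<b

  distance-above : ∀ {t} → b ≤ t → distance (suc t) ≡ suc (distance t)
  distance-above {t} b≤t = begin
    (a ∸ suc t) + (suc t ∸ b)  ≡⟨ cong₂ _+_ (m≤n⇒m∸n≡0 (m≤n⇒m≤1+n a≤t)) (+-∸-assoc 1 b≤t) ⟩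
    suc (t ∸ b)                ≡⟨ cong (λ x → suc (x + (t ∸ b))) (sym (m≤n⇒m∸n≡0 a≤t)) ⟩
    suc ((a ∸ t) + (t ∸ b))    ∎
    where a≤t = <⇒≤ (<-≤-trans a<b b≤t)

  distance-step : ∀ t → distance (suc t) ≡ suc (distance t) ⊎
                        distance t ≡ suc (distance (suc t)) ⊎ distance t ≡ 0
  distance-step t with t <? a | b ≤? t
  ... | yes t<a | _       = inj₂ (inj₁ (distance-below t<a))
  ... | no  _   | yes b≤t = inj₁ (distance-above b≤t)
  ... | no  t≮a | no  b≰t =
    inj₂ (inj₂ (cong₂ _+_ (m≤n⇒m∸n≡0 (≮⇒≥ t≮a)) (m≤n⇒m∸n≡0 (<⇒≤ (≰⇒> b≰t)))))

  distance≡0⇒inside : ∀ {t} → distance t ≡ 0 → a ≤ t × t ≤ b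
  distance≡0⇒inside {t} d≡0 =
    m∸n≡0⇒m≤n (m+n≡0⇒m≡0 (a ∸ t) d≡0) , m∸n≡0⇒m≤n (m+n≡0⇒n≡0 (a ∸ t) d≡0)

  distance≢0⇒Outside : ∀ {t} → distance t ≢ 0 → Outside t
  distance≢0⇒Outside {t} d≢0 with t <? a | b <? t
  ... | yes t<a | _       = inj₁ t<a
  ... | no  _   | yes b<t = inj₂ b<t
  ... | no  t≮a | no  t≯b =
    contradiction (cong₂ _+_ (m≤n⇒m∸n≡0 (≮⇒≥ t≮a)) (m≤n⇒m∸n≡0 (≮⇒≥ t≯b))) d≢0

  inward-below : ∀ {t} → t < a → inward t ≡ suc t
  inward-below {t} t<a with t <? a
  ... | yes _   = refl
  ... | no  t≮a = contradiction t<a t≮a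

  inward-above : ∀ {t} → b < t → inward t ≡ t ∸ 1
  inward-above {t} b<t with t <? a
  ... | yes t<a = contradiction (<-trans t<a (<-trans a<b b<t)) (<-irrefl refl)
  ... | no  _   = refl

  distance-inward : ∀ {t} → Outside t → distance t ≡ suc (distance (inward t))
  distance-inward (inj₁ t<a) rewrite inward-below t<a = distance-below t<a
  distance-inward {suc t} (inj₂ b<t) rewrite inward-above b<t = distance-above (≤-pred b<t)

  inward-separated : ∀ {s t} → s < a → b < suc t → suc s < t
  inward-separated s<a b<t = <-≤-trans (≤-<-trans s<a a<b) (≤-pred b<t)

  inward-injective : ∀ {s t} → Outside s → Outside t → inward s ≡ inward t → s ≡ t
  inward-injective (inj₁ s<a) (inj₁ t<a) eq
    rewrite inward-below s<a | inward-below t<a = suc-injective eq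
  inward-injective {suc s} {suc t} (inj₂ b<s) (inj₂ b<t) eq
    rewrite inward-above b<s | inward-above b<t = cong suc eq
  inward-injective {s} {suc t} (inj₁ s<a) (inj₂ b<t) eq
    rewrite inward-below s<a | inward-above b<t =
      contradiction (inward-separated s<a b<t) (<-irrefl eq)
  inward-injective {suc s} {t} (inj₂ b<s) (inj₁ t<a) eq
    rewrite inward-above b<s | inward-below t<a =
      contradiction (inward-separated t<a b<s) (<-irrefl (sym eq))

data Role : Set where
  free saturated cover : Role

_≟ᴿ_ : (r s : Role) → Dec (r ≡ s)
free      ≟ᴿ free      = yes refl
saturated ≟ᴿ saturated = yes refl
cover     ≟ᴿ cover     = yes refl
free      ≟ᴿ saturated = no λ ()
free      ≟ᴿ cover     = no λ ()
saturated ≟ᴿ free      = no λ ()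
saturated ≟ᴿ cover     = no λ ()
cover     ≟ᴿ free      = no λ ()
cover     ≟ᴿ saturated = no λ ()

next : Role → Role
next cover     = saturated
next saturated = free
next free      = cover

next-injective : ∀ {r s} → next r ≡ next s → r ≡ s
next-injective {free}      {free}      _ = refl
next-injective {saturated} {saturated} _ = refl
next-injective {cover}     {cover}     _ = refl

rotate : Role → ℕ → Role
rotate p zero    = p
rotate p (suc d) = next (rotate p d)

rotate-injective : ∀ {p q} d → rotate p d ≡ rotate q d → p ≡ q
rotate-injective zero    eq = eq
rotate-injective (suc d) eq = rotate-injective d (next-injective eq)

role : Role → ℕ → Role
role p zero    = cover
role p (suc d) = rotate p (suc d)

role-saturated : ∀ p d → role p (suc d) ≡ saturated → role p d ≡ cover
role-saturated p zero    _  = refl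
role-saturated p (suc d) eq = next≡saturated (rotate p (suc d)) eq
  where
  next≡saturated : ∀ r → next r ≡ saturated → r ≡ cover
  next≡saturated cover _ = refl

role-unsaturated : ∀ p d → role p d ≢ saturated → role p (suc d) ≢ saturated →
                   role p d ≡ cover ⊎ role p (suc d) ≡ cover
role-unsaturated p zero    _ _ = inj₁ refl
role-unsaturated p (suc d) = step (rotate p (suc d))
  where
  step : ∀ r → r ≢ saturated → next r ≢ saturated → r ≡ cover ⊎ next r ≡ cover
  step free      _   _ = inj₂ refl
  step saturated r≢s _ = contradiction refl r≢s
  step cover     _   _ = inj₁ refl

role≡cover : ∀ p d → role p d ≡ cover → d ≡ 0 ⊎ rotate p d ≡ cover
role≡cover p zero    _  = inj₁ refl
role≡cover p (suc d) eq = inj₂ eq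

Σ₃ : (Role → ℕ) → ℕ
Σ₃ f = f free + f saturated + f cover

Σ₃-mono : ∀ {f g : Role → ℕ} → (∀ p → f p ≤ g p) → Σ₃ f ≤ Σ₃ g
Σ₃-mono f≤g = +-mono-≤ (+-mono-≤ (f≤g free) (f≤g saturated)) (f≤g cover)

Σ₃-shift : ∀ x (f : Role → ℕ) → Σ₃ (λ p → x + f p) ≡ 3 * x + Σ₃ f
Σ₃-shift x f = solve 4 (λ x a b c → (x :+ a) :+ (x :+ b) :+ (x :+ c) := con 3 :* x :+ (a :+ b :+ c))
                 refl x (f free) (f saturated) (f cover)
  where open +-*-Solver

argmin : (f : Role → ℕ) → ∃[ p ] (∀ q → f p ≤ f q)
argmin f with ≤-total (f free) (f saturated)
argmin f | inj₁ f≤s with ≤-total (f free) (f cover)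
... | inj₁ f≤c = free  , λ { free → ≤-refl ; saturated → f≤s ; cover → f≤c }
... | inj₂ c≤f = cover , λ { free → c≤f ; saturated → ≤-trans c≤f f≤s ; cover → ≤-refl }
argmin f | inj₂ s≤f with ≤-total (f saturated) (f cover)
... | inj₁ s≤c = saturated , λ { free → s≤f ; saturated → ≤-refl ; cover → s≤c }
... | inj₂ c≤s = cover     , λ { free → ≤-trans c≤s s≤f ; saturated → c≤s ; cover → ≤-refl }

below-average : (f : Role → ℕ) → ∃[ p ] 3 * f p ≤ Σ₃ f
below-average f with argmin f
... | p , min = p , (begin
  3 * f p          ≡⟨ solve 1 (λ x → con 3 :* x := x :+ x :+ x) refl (f p) ⟩
  f p + f p + f p  ≤⟨ +-mono-≤ (+-mono-≤ (min free) (min saturated)) (min cover) ⟩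
  Σ₃ f             ∎)
  where
  open ≤-Reasoning
  open +-*-Solver

AllPairs-restrict : ∀ {A : Set} {P : A → Set} {R S : A → A → Set} {xs} →
                    (∀ {x y} → P x → P y → R x y → S x y) → All P xs → AllPairs R xs → AllPairs S xs
AllPairs-restrict f []         []         = []
AllPairs-restrict f (px ∷ pxs) (rx ∷ rxs) =
  All.zipWith (λ (py , rxy) → f px py rxy) (pxs , rx) ∷ AllPairs-restrict f pxs rxs

⌈n/2⌉≤1+⌊n/2⌋ : ∀ n → ⌈ n /2⌉ ≤ suc ⌊ n /2⌋
⌈n/2⌉≤1+⌊n/2⌋ zero          = z≤n
⌈n/2⌉≤1+⌊n/2⌋ (suc zero)    = s≤s z≤n
⌈n/2⌉≤1+⌊n/2⌋ (suc (suc n)) = s≤s (⌈n/2⌉≤1+⌊n/2⌋ n)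

module Layering {n ℓ : ℕ} (G : Graph n) (layer : Fin n → Fin (suc ℓ))
  (consecutive : Layered.EdgesBetweenConsecutive G layer)
  (expandUp : Layered.ExpandUp G layer) (expandDown : Layered.ExpandDown G layer) where

  open Layered G layer
  open Matchings G

  h h′ : ℕ
  h  = ⌊ ℓ /2⌋
  h′ = ⌈ ℓ /2⌉

  -- The band must reach ⌈ℓ/2⌉ + 1: for even ℓ the band [h, h′] would let the layers h ± 1
  -- both be matched into the layer h.
  open Interval h (suc h′) (s≤s (⌊n/2⌋≤⌈n/2⌉ ℓ))

  level : Fin n → ℕ
  level v = toℕ (layer v)

  level≤ℓ : ∀ v → level v ≤ ℓ
  level≤ℓ v = ≤-pred (toℕ<n (layer v))

  depth : Fin n → ℕ
  depth v = distance (level v)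

  ∈-Part : ∀ {v j} → v ∈ Part j ⇔ level v ≡ j
  ∈-Part {v} {j} = mk⇔ (≡ᵇ⇒≡ (level v) j ∘ to ∈-tabulate) (from ∈-tabulate ∘ ≡⇒≡ᵇ (level v) j)

  ∈-Nbrs⁻ : ∀ {X j v} → v ∈ Nbrs X j → v ∈ Part j × ∃[ u ] u ∈ X × IsEdge G (u , v)
  ∈-Nbrs⁻ v∈N =
    let v∈Pj , some-u = to T-∧ (to ∈-tabulate v∈N)
        u , u∈X∧uv    = anyFin⁻ some-u
        u∈X , uv      = to T-∧ u∈X∧uv
    in from ∈-tabulate v∈Pj , u , from ∈⇔T-lookup u∈X , uv

  Nbrs⊆Part : ∀ {X j} → Nbrs X j ⊆ Part j
  Nbrs⊆Part {X} = proj₁ ∘ ∈-Nbrs⁻ {X}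

  towards : ℕ → Fin n → Subset n
  towards j u = Part j ∩ tabulate (adj G u)

  Nbrs⊆neighbourhood : ∀ {X j} → Nbrs X j ⊆ neighbourhood (towards j) X
  Nbrs⊆neighbourhood v∈N =
    let v∈Pj , u , u∈X , uv = ∈-Nbrs⁻ v∈N
    in ∈-neighbourhood⁺ u∈X (x∈p∩q⁺ (v∈Pj , from ∈-tabulate uv))

  hallCondition-inward : ∀ {t} → Outside t → t ≤ ℓ → HallCondition (towards (inward t)) (Part t)
  hallCondition-inward {t} (inj₁ t<h) _ X X⊆Pt rewrite inward-below t<h =
    ≤-trans (expandUp t t<h X X⊆Pt) (p⊆q⇒∣p∣≤∣q∣ Nbrs⊆neighbourhood)
  hallCondition-inward {t} (inj₂ 1+h′<t) t≤ℓ X X⊆Pt rewrite inward-above 1+h′<t =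
    ≤-trans (expandDown t (<-trans (n<1+n h′) 1+h′<t) t≤ℓ X X⊆Pt)
            (p⊆q⇒∣p∣≤∣q∣ Nbrs⊆neighbourhood)

  inwardMatching : ∀ t → ∃[ f ] (Outside t → t ≤ ℓ → Saturates (towards (inward t)) (Part t) f)
  inwardMatching t with outside? t | t ≤? ℓ
  ... | yes out  | yes t≤ℓ =
    let f , f-sat = hall _ _ (hallCondition-inward out t≤ℓ) in f , λ _ _ → f-sat
  ... | yes _    | no  t≰ℓ = id , λ _ t≤ℓ → contradiction t≤ℓ t≰ℓ
  ... | no  ¬out | _       = id , λ out → contradiction out ¬out

  partner : Fin n → Fin n
  partner u = proj₁ (inwardMatching (level u)) u

  module _ {u} (out : Outside (level u)) where

    partner-saturates :
      Saturates (towards (inward (level u))) (Part (level u)) (proj₁ (inwardMatching (level u)))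
    partner-saturates = proj₂ (inwardMatching (level u)) out (level≤ℓ u)

    partner-towards : partner u ∈ towards (inward (level u)) u
    partner-towards = proj₁ partner-saturates (from ∈-Part refl)

    partner-adjacent : IsEdge G (u , partner u)
    partner-adjacent = to ∈-tabulate (proj₂ (x∈p∩q⁻ _ _ partner-towards))

    partner-level : level (partner u) ≡ inward (level u)
    partner-level = to ∈-Part (proj₁ (x∈p∩q⁻ _ _ partner-towards))

  partner-injective : ∀ {u w} → Outside (level u) → Outside (level w) →
                      partner u ≡ partner w → u ≡ w
  partner-injective {u} {w} out-u out-w pu≡pw =
    proj₂ (partner-saturates out-u) (from ∈-Part refl) (from ∈-Part (sym same-level))
      (trans pu≡pw (cong (λ t → proj₁ (inwardMatching t) w) (sym same-level)))
    where
    same-level : level u ≡ level w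
    same-level = inward-injective out-u out-w
      (trans (sym (partner-level out-u)) (trans (cong level pu≡pw) (partner-level out-w)))

  module Phase (p : Role) where

    roleOf : Fin n → Role
    roleOf v = role p (depth v)

    Saturated : Fin n → Set
    Saturated v = roleOf v ≡ saturated

    covers : Subset n
    covers = subset (λ v → roleOf v ≟ᴿ cover)

    saturated⇒Outside : ∀ {u} → Saturated u → Outside (level u)
    saturated⇒Outside sat = distance≢0⇒Outside λ d≡0 →
      contradiction (subst (λ d → role p d ≡ saturated) d≡0 sat) λ ()

    partner-cover : ∀ {u} → Saturated u → roleOf (partner u) ≡ cover
    partner-cover {u} sat = trans (cong (role p ∘ distance) (partner-level out))
      (role-saturated p (distance (inward (level u)))
        (subst (λ d → role p d ≡ saturated) (distance-inward out) sat))
      where out = saturated⇒Outside sat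

    saturatedVertices : List (Fin n)
    saturatedVertices = filter (λ v → roleOf v ≟ᴿ saturated) (allFin n)

    all-saturated : All Saturated saturatedVertices
    all-saturated = Allₚ.all-filter _ (allFin n)

    inwardEdges : List (Vertex-pair n)
    inwardEdges = map (λ u → u , partner u) saturatedVertices

    inwardEdges-matching : IsMatching G inwardEdges
    inwardEdges-matching =
      Allₚ.map⁺ (All.map (partner-adjacent ∘ saturated⇒Outside) all-saturated) ,
      AllPairsₚ.map⁺ (AllPairs-restrict disjoint all-saturated (AllPairsₚ.filter⁺ _ (allFin⁺ n)))
      where
      saturated≢cover : ∀ {u v} → Saturated u → roleOf v ≡ cover → u ≢ v
      saturated≢cover sat-u cov-v refl with () ← trans (sym sat-u) cov-v

      disjoint : ∀ {u w} → Saturated u → Saturated w → u ≢ w →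
                 Disjoint G (u , partner u) (w , partner w)
      disjoint sat-u sat-w u≢w =
        u≢w , saturated≢cover sat-u (partner-cover sat-w) ,
        (λ pu≡w → saturated≢cover sat-w (partner-cover sat-u) (sym pu≡w)) ,
        u≢w ∘ partner-injective (saturated⇒Outside sat-u) (saturated⇒Outside sat-w)

    inwardEdges-meet-covers : All (Meets covers) inwardEdges
    inwardEdges-meet-covers =
      Allₚ.map⁺ (All.map (λ sat → _ , inj₂ refl , from ∈-subset (partner-cover sat)) all-saturated)

    saturated⇒covered : ∀ {u} → Saturated u → Covered u inwardEdges
    saturated⇒covered {u} sat = lose (∈-map⁺ _ (∈-filter⁺ _ (∈-allFin u) sat)) (inj₁ refl)

    consecutive-levels : ∀ t → role p (distance t) ≢ saturated →
                         role p (distance (suc t)) ≢ saturated →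
                         role p (distance t) ≡ cover ⊎ role p (distance (suc t)) ≡ cover
    consecutive-levels t with distance-step t
    ... | inj₁ eq        rewrite eq = role-unsaturated p (distance t)
    ... | inj₂ (inj₁ eq) rewrite eq = λ ¬sat ¬sat′ →
      Sum.swap (role-unsaturated p (distance (suc t)) ¬sat′ ¬sat)
    ... | inj₂ (inj₂ eq) rewrite eq = λ _ _ → inj₁ refl

    consecutive-vertices : ∀ {u v} → level v ≡ suc (level u) → ¬ Saturated u → ¬ Saturated v →
                           roleOf u ≡ cover ⊎ roleOf v ≡ cover
    consecutive-vertices {u} v-above ¬sat-u ¬sat-v =
      subst (λ t → roleOf u ≡ cover ⊎ role p (distance t) ≡ cover) (sym v-above)
        (consecutive-levels (level u) ¬sat-u
          (subst (λ t → role p (distance t) ≢ saturated) v-above ¬sat-v))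

    cover-endpoint : ∀ {w e} → Endpoint w e → roleOf w ≡ cover → Meets covers e
    cover-endpoint w∈e cov = _ , w∈e , from ∈-subset cov

    free-meets-covers : ∀ {e} → Free inwardEdges e → Meets covers e
    free-meets-covers {u , v} (uv , ¬u-covered , ¬v-covered) with consecutive u v uv
    ... | inj₁ v-above = [ cover-endpoint (inj₁ refl) , cover-endpoint (inj₂ refl) ]
      (consecutive-vertices v-above (¬u-covered ∘ saturated⇒covered) (¬v-covered ∘ saturated⇒covered))
    ... | inj₂ u-above = [ cover-endpoint (inj₂ refl) , cover-endpoint (inj₁ refl) ]
      (consecutive-vertices u-above (¬v-covered ∘ saturated⇒covered) (¬u-covered ∘ saturated⇒covered))

    phase-matching : ∃[ M ] IsMaximalMatching G M × length M ≤ ∣ covers ∣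
    phase-matching =
      let M , maximal , meets = extend-to-maximal (Meets covers) inwardEdges free-meets-covers
                                  inwardEdges-matching inwardEdges-meet-covers
      in M , maximal , length≤∣S∣ (proj₂ (proj₁ maximal)) meets

  band : Subset n
  band = subset (λ v → depth v ≟ 0)

  cyclicCovers : Role → Subset n
  cyclicCovers p = subset (λ v → rotate p (depth v) ≟ᴿ cover)

  covers⊆band∪cyclicCovers : ∀ p → Phase.covers p ⊆ band ∪ cyclicCovers p
  covers⊆band∪cyclicCovers p v∈C =
    x∈p∪q⁺ (Sum.map (from ∈-subset) (from ∈-subset) (role≡cover p _ (to ∈-subset v∈C)))

  cyclicCovers-disjoint : ∀ {p q} → p ≢ q → Empty (cyclicCovers p ∩ cyclicCovers q)
  cyclicCovers-disjoint p≢q (v , v∈Ep∩Eq) =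
    let v∈Ep , v∈Eq = x∈p∩q⁻ _ _ v∈Ep∩Eq
    in p≢q (rotate-injective (depth v) (trans (to ∈-subset v∈Ep) (sym (to ∈-subset v∈Eq))))

  Σ∣cyclicCovers∣≤n : Σ₃ (∣_∣ ∘ cyclicCovers) ≤ n
  Σ∣cyclicCovers∣≤n = begin
    ∣ Ef ∣ + ∣ Es ∣ + ∣ Ec ∣
      ≤⟨ +-monoˡ-≤ ∣ Ec ∣ (Empty[p∩q]⇒∣p∣+∣q∣≤∣p∪q∣ Ef Es (cyclicCovers-disjoint λ ())) ⟩
    ∣ Ef ∪ Es ∣ + ∣ Ec ∣
      ≤⟨ Empty[p∩q]⇒∣p∣+∣q∣≤∣p∪q∣ (Ef ∪ Es) Ec [Ef∪Es]∩Ec≡∅ ⟩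
    ∣ (Ef ∪ Es) ∪ Ec ∣
      ≤⟨ ∣p∣≤n ((Ef ∪ Es) ∪ Ec) ⟩
    n ∎
    where
    open ≤-Reasoning
    Ef = cyclicCovers free
    Es = cyclicCovers saturated
    Ec = cyclicCovers cover

    [Ef∪Es]∩Ec≡∅ : Empty ((Ef ∪ Es) ∩ Ec)
    [Ef∪Es]∩Ec≡∅ (v , v∈) with x∈p∩q⁻ (Ef ∪ Es) Ec v∈
    ... | v∈Ef∪Es , v∈Ec with x∈p∪q⁻ Ef Es v∈Ef∪Es
    ...   | inj₁ v∈Ef = cyclicCovers-disjoint (λ ()) (v , x∈p∩q⁺ (v∈Ef , v∈Ec))
    ...   | inj₂ v∈Es = cyclicCovers-disjoint (λ ()) (v , x∈p∩q⁺ (v∈Es , v∈Ec))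

  Σ∣covers∣≤3∣band∣+n : Σ₃ (λ p → ∣ Phase.covers p ∣) ≤ 3 * ∣ band ∣ + n
  Σ∣covers∣≤3∣band∣+n = begin
    Σ₃ (λ p → ∣ Phase.covers p ∣)
      ≤⟨ Σ₃-mono (λ p → ≤-trans (p⊆q⇒∣p∣≤∣q∣ (covers⊆band∪cyclicCovers p)) (∣p∪q∣≤∣p∣+∣q∣ band _)) ⟩
    Σ₃ (λ p → ∣ band ∣ + ∣ cyclicCovers p ∣)
      ≡⟨ Σ₃-shift ∣ band ∣ (∣_∣ ∘ cyclicCovers) ⟩
    3 * ∣ band ∣ + Σ₃ (∣_∣ ∘ cyclicCovers)
      ≤⟨ +-monoʳ-≤ (3 * ∣ band ∣) Σ∣cyclicCovers∣≤n ⟩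
    3 * ∣ band ∣ + n ∎
    where open ≤-Reasoning

  middle-levels : ∀ {t} → h ≤ t → t ≤ suc h′ → t ≡ h ⊎ t ≡ h′ ⊎ t ≡ suc h′
  middle-levels {t} h≤t t≤1+h′ with m≤n⇒m<n∨m≡n t≤1+h′ | m≤n⇒m<n∨m≡n h≤t
  ... | inj₂ t≡1+h′ | _        = inj₂ (inj₂ t≡1+h′)
  ... | inj₁ _      | inj₂ h≡t = inj₁ (sym h≡t)
  ... | inj₁ t<1+h′ | inj₁ h<t =
    inj₂ (inj₁ (≤-antisym (≤-pred t<1+h′) (≤-trans (⌈n/2⌉≤1+⌊n/2⌋ ℓ) h<t)))

  band⊆middleParts : band ⊆ Part h ∪ (Part h′ ∪ Part (suc h′))
  band⊆middleParts v∈band with distance≡0⇒inside (to ∈-subset v∈band)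
  ... | h≤t , t≤1+h′ with middle-levels h≤t t≤1+h′
  ...   | inj₁ t≡h           = x∈p∪q⁺ (inj₁ (from ∈-Part t≡h))
  ...   | inj₂ (inj₁ t≡h′)   = x∈p∪q⁺ (inj₂ (x∈p∪q⁺ (inj₁ (from ∈-Part t≡h′))))
  ...   | inj₂ (inj₂ t≡1+h′) = x∈p∪q⁺ (inj₂ (x∈p∪q⁺ (inj₂ (from ∈-Part t≡1+h′))))

  ∣Part-1+h′∣≤∣Part-h′∣ : ∣ Part (suc h′) ∣ ≤ ∣ Part h′ ∣
  ∣Part-1+h′∣≤∣Part-h′∣ with suc h′ ≤? ℓ
  ... | yes 1+h′≤ℓ = ≤-trans (expandDown (suc h′) ≤-refl 1+h′≤ℓ (Part (suc h′)) id)
                             (p⊆q⇒∣p∣≤∣q∣ (Nbrs⊆Part {Part (suc h′)}))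
  ... | no  1+h′≰ℓ = p⊆q⇒∣p∣≤∣q∣ {q = Part h′} λ {v} v∈P →
    contradiction (subst (_≤ ℓ) (to ∈-Part v∈P) (level≤ℓ v)) 1+h′≰ℓ

  m : ℕ
  m = ∣ Part h ∣ ⊔ ∣ Part h′ ∣

  ∣band∣≤3m : ∣ band ∣ ≤ 3 * m
  ∣band∣≤3m = begin
    ∣ band ∣                                        ≤⟨ p⊆q⇒∣p∣≤∣q∣ band⊆middleParts ⟩
    ∣ Part h ∪ (Part h′ ∪ Part (suc h′)) ∣          ≤⟨ ∣p∪q∣≤∣p∣+∣q∣ (Part h) _ ⟩
    ∣ Part h ∣ + ∣ Part h′ ∪ Part (suc h′) ∣        ≤⟨ +-monoʳ-≤ ∣ Part h ∣ (∣p∪q∣≤∣p∣+∣q∣ (Part h′) _) ⟩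
    ∣ Part h ∣ + (∣ Part h′ ∣ + ∣ Part (suc h′) ∣)  ≤⟨ +-mono-≤ ∣Ph∣≤m (+-mono-≤ ∣Ph′∣≤m ∣P[1+h′]∣≤m) ⟩
    m + (m + m)                                     ≡⟨ solve 1 (λ m → m :+ (m :+ m) := con 3 :* m) refl m ⟩
    3 * m                                           ∎
    where
    open ≤-Reasoning
    open +-*-Solver
    ∣Ph∣≤m       = m≤m⊔n ∣ Part h ∣ ∣ Part h′ ∣
    ∣Ph′∣≤m      = m≤n⊔m ∣ Part h ∣ ∣ Part h′ ∣
    ∣P[1+h′]∣≤m = ≤-trans ∣Part-1+h′∣≤∣Part-h′∣ ∣Ph′∣≤m

proposition4p2 : (n ℓ : ℕ) (G : Graph n) (layer : Fin n → Fin (suc ℓ)) →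
    Layered.EdgesBetweenConsecutive G layer →
    Layered.ExpandUp G layer →
    Layered.ExpandDown G layer →
    Σ (List (Vertex-pair n)) (λ M → IsMaximalMatching G M ×
      3 * length M ≤ n + 18 * (∣ Layered.Part G layer ⌊ ℓ /2⌋ ∣ ⊔ ∣ Layered.Part G layer ⌈ ℓ /2⌉ ∣))
proposition4p2 n ℓ G layer consecutive expandUp expandDown =
  let p , 3∣Cp∣≤Σ = below-average (λ p → ∣ Phase.covers p ∣)
      M , maximal , ∣M∣≤∣Cp∣ = Phase.phase-matching p
  in M , maximal , (begin
    3 * length M                   ≤⟨ *-monoʳ-≤ 3 ∣M∣≤∣Cp∣ ⟩
    3 * ∣ Phase.covers p ∣         ≤⟨ 3∣Cp∣≤Σ ⟩
    Σ₃ (λ p → ∣ Phase.covers p ∣)  ≤⟨ Σ∣covers∣≤3∣band∣+n ⟩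
    3 * ∣ band ∣ + n               ≤⟨ +-monoˡ-≤ n (*-monoʳ-≤ 3 ∣band∣≤3m) ⟩
    3 * (3 * m) + n                ≡⟨ solve 2 (λ m n → con 3 :* (con 3 :* m) :+ n := n :+ con 9 :* m)
                                            refl m n ⟩
    n + 9 * m                      ≤⟨ +-monoʳ-≤ n (*-monoˡ-≤ m (m≤m+n 9 9)) ⟩
    n + 18 * m                     ∎)
  where
  open Layering G layer consecutive expandUp expandDown
  open ≤-Reasoning
  open +-*-Solver
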